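{- Let $\mathcal{A}$ and $\mathcal{B}$ be nice GFG-tNCWs over the same alphabet with disjoint state sets $Q_\mathcal{A},Q_\mathcal{B}$ and with $L(\mathcal{A})=L(\mathcal{B})$. Then for every state $q\in Q_\mathcal{A}$ there is a state $s\in Q_\mathcal{B}$ such that $q\precsim s$, i.e., $L(\mathcal{A}^q)=L(\mathcal{B}^s)$ and $L_{safe}(\mathcal{A}^q)\subseteq L_{safe}(\mathcal{B}^s)$.
   Context: A tNCW is $\mathcal{A}=\langle \Sigma,Q,q_0,\delta,\alpha\rangle$ with finite alphabet $\Sigma$, finite state set $Q$, initial state $q_0$, total transition function $\delta:Q\times\Sigma\to 2^Q\setminus\{\emptyset\}$ with transition relation $\Delta=\{\langle q,\sigma,s\rangle: s\in\delta(q,\sigma)\}$, and $\alpha\subseteq\Delta$ ($\alpha$-transitions; the rest are $\bar\alpha$-transitions); $\delta^{\bar\alpha}(q,\sigma)$ is the set of $\sigma$-successors of $q$ via $\bar\alpha$-transitions. A run on $w=\sigma_1\sigma_2\cdots$ is $r_0r_1\cdots$ with $r_0=q_0$, $r_{i+1}\in\delta(r_i,\sigma_{i+1})$, accepting iff it traverses $\alpha$-transitions only finitely often. $\mathcal{A}^q$ is $\mathcal{A}$ with initial state $q$. $\mathcal{A}$ is GFG if there is $f:\Sigma^*\to Q$ with $f(\epsilon)=q_0$, $\langle f(u),\sigma,f(u\sigma)\rangle\in\Delta$ for all $u,\sigma$, and for every $w\in L(\mathcal{A})$ the run $f(w[1,0]),f(w[1,1]),\dots$ is accepting; a state $q$ is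 GFG if $\mathcal{A}^q$ is. A run is safe if it uses no $\alpha$-transition; $L_{safe}(\mathcal{A}^q)$ is the set of infinite words with a safe run from $q$. Within one automaton, $q\sim s$ iff $L(\mathcal{A}^q)=L(\mathcal{A}^s)$. $\mathcal{A}$ is semantically deterministic if any two $\sigma$-successors of a state are $\sim$-equivalent; safe deterministic if $|\delta^{\bar\alpha}(q,\sigma)|\le1$; normal if a path of $\bar\alpha$-transitions from $q$ to $s$ implies one from $s$ to $q$. A GFG-tNCW is nice if all states are reachable and GFG and it is normal, safe deterministic and semantically deterministic. -}

module Defs where

open import Data.Nat using (ℕ; zero; suc; _≤_)
open import Data.Fin using (Fin)
open import Data.Bool using (Bool; true; false)
open import Data.List using (List; []; _∷_; _∷ʳ_)
open import Data.Product using (Σ; ∃; _×_; _,_)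
open import Relation.Binary.PropositionalEquality using (_≡_)

record TNCW (k n : ℕ) : Set where
  field
    q₀    : Fin n
    δ     : Fin n → Fin k → Fin n → Bool
    total : ∀ q σ → ∃ λ s → δ q σ s ≡ true
    α     : Fin n → Fin k → Fin n → Bool
    α⊆Δ   : ∀ q σ s → α q σ s ≡ true → δ q σ s ≡ true

module _ {k n : ℕ} (A : TNCW k n) where
  open TNCW A

  -- infinite words σ₁σ₂⋯ are functions ℕ → Σ with  w i = σ_{i+1}
  Word : Set
  Word = ℕ → Fin k

  IsRun : Fin n → Word → (ℕ → Fin n) → Set
  IsRun q w r = (r 0 ≡ q) × (∀ i → δ (r i) (w i) (r (suc i)) ≡ true)

  Accepting : Word → (ℕ → Fin n) → Set
  Accepting w r = ∃ λ N → ∀ i → N ≤ i → α (r i) (w i) (r (suc i)) ≡ false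

  SafeRun : Word → (ℕ → Fin n) → Set
  SafeRun w r = ∀ i → α (r i) (w i) (r (suc i)) ≡ false

  Lang : Fin n → Word → Set
  Lang q w = ∃ λ r → IsRun q w r × Accepting w r

  LangSafe : Fin n → Word → Set
  LangSafe q w = ∃ λ r → IsRun q w r × SafeRun w r

  prefix : Word → ℕ → List (Fin k)
  prefix w zero    = []
  prefix w (suc i) = prefix w i ∷ʳ w i

  IsGFGState : Fin n → Set
  IsGFGState q =
    Σ (List (Fin k) → Fin n) λ f →
      (f [] ≡ q) ×
      (∀ u σ → δ (f u) σ (f (u ∷ʳ σ)) ≡ true) ×
      (∀ w → Lang q w → Accepting w (λ i → f (prefix w i)))

  Path : Fin n → List (Fin k) → Fin n → Set
  Path q []      s = q ≡ s
  Path q (σ ∷ u) s = ∃ λ q' → (δ q σ q' ≡ true) × Path q' u s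

  SafePath : Fin n → List (Fin k) → Fin n → Set
  SafePath q []      s = q ≡ s
  SafePath q (σ ∷ u) s =
    ∃ λ q' → (δ q σ q' ≡ true) × (α q σ q' ≡ false) × SafePath q' u s

  Reachable : Fin n → Set
  Reachable q = ∃ λ u → Path q₀ u q

  Equiv : Fin n → Fin n → Set
  Equiv q s = ∀ w → (Lang q w → Lang s w) × (Lang s w → Lang q w)

  SemanticallyDeterministic : Set
  SemanticallyDeterministic =
    ∀ q σ s s' → δ q σ s ≡ true → δ q σ s' ≡ true → Equiv s s'

  SafeDeterministic : Set
  SafeDeterministic =
    ∀ q σ s s' → δ q σ s ≡ true → α q σ s ≡ false →
                 δ q σ s' ≡ true → α q σ s' ≡ false → s ≡ s'

  Normal : Set
  Normal = ∀ q s → (∃ λ u → SafePath q u s) → (∃ λ v → SafePath s v q)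

  record Nice : Set where
    field
      allReachable : ∀ q → Reachable q
      allGFG       : ∀ q → IsGFGState q
      normal       : Normal
      safeDet      : SafeDeterministic
      semDet       : SemanticallyDeterministic

-- Because B is safe deterministic, the pairs (a, b) with L_safe(A^a) ⊆ L_safe(B^b) are exactly the
-- greatest safe simulation, which is computed as a fixpoint; every other pair is refuted by a finite
-- word that A reads safely from a but B cannot read safely from b. Let g be a GFG strategy of B and
-- u a word leading A to q. By semantic determinism g h ∼ q for every history h that continues u by
-- safe loops of A at q, so it suffices that some such g h safely covers q. Otherwise, from q pump
-- loops (closed by normality) that the current g h cannot follow safely: the resulting word lies in
-- L(A) = L(B), so the run of g on it is eventually safe, and the first loop read inside that safe
-- suffix is followed safely, a contradiction. Constructively, this is an induction on the position
-- from which that run is safe.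

module Submission where

open import Defs
open import Data.Nat using (ℕ; zero; suc; _+_; _*_; _≤_; z≤n; s≤s)
open import Data.Nat.Properties using (≤-trans; m≤n+m; n≤1+n)
open import Data.Fin using (Fin; combine; remQuot)
open import Data.Fin.Properties using (any?; remQuot-combine)
open import Data.Fin.Subset using (Subset; _∈_; _⊆_; _⊂_; ⊤)
open import Data.Fin.Subset.Properties using (_∈?_; ∈⊤; ⊆⊤)
open import Data.Fin.Subset.Induction using (⊂-wellFounded; Acc; acc)
open import Data.Bool using (true; false)
import Data.Bool.Properties as Bool
open import Data.List using (List; []; _∷_; _∷ʳ_; _++_; [_]; foldl; length)
open import Data.List.Properties using (++-assoc; ++-identityʳ)
open import Data.List.NonEmpty as List⁺ using (List⁺; _∷_; toList)
open import Data.Vec using (tabulate)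
open import Data.Vec.Properties using (lookup∘tabulate; []=⇒lookup; lookup⇒[]=)
open import Data.Product using (Σ; ∃; ∃₂; _×_; _,_; proj₁; proj₂; uncurry)
open import Data.Sum using (_⊎_; inj₁; inj₂; [_,_]′)
open import Data.Empty using (⊥-elim)
open import Function using (id)
open import Relation.Nullary using (¬_; Dec; yes; no; does; _×-dec_; ¬?)
open import Relation.Nullary.Decidable using (decidable-stable; dec-true)
open import Relation.Binary.PropositionalEquality using (_≡_; refl; sym; trans; cong; subst; subst₂)

_∷ω_ : ∀ {k} → Fin k → (ℕ → Fin k) → ℕ → Fin k
(σ ∷ω w) zero    = σ
(σ ∷ω w) (suc i) = w i

_++ω_ : ∀ {k} → List (Fin k) → (ℕ → Fin k) → ℕ → Fin k
[]      ++ω w = w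
(σ ∷ u) ++ω w = σ ∷ω (u ++ω w)

tailω : ∀ {k} → (ℕ → Fin k) → ℕ → Fin k
tailω w i = w (suc i)

-- h ++ x, computed by snoc so that it unfolds one letter of x at a time.
after : ∀ {k} → List (Fin k) → List (Fin k) → List (Fin k)
after = foldl _∷ʳ_

module Automaton {k n : ℕ} (X : TNCW k n) where
  open TNCW X

  SafeEdge : Fin n → Fin k → Fin n → Set
  SafeEdge q σ s = δ q σ s ≡ true × α q σ s ≡ false

  safeEdge? : ∀ q σ s → Dec (SafeEdge q σ s)
  safeEdge? q σ s = (δ q σ s Bool.≟ true) ×-dec (α q σ s Bool.≟ false)

  Lang-∷ω : ∀ {q q′ σ w} → δ q σ q′ ≡ true → Lang X q′ w → Lang X q (σ ∷ω w)
  Lang-∷ω {q} {σ = σ} d (r , (refl , steps) , (N , late)) = run , (refl , steps′) , (suc N , late′)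
    where
    run : ℕ → Fin n
    run zero    = q
    run (suc i) = r i
    steps′ : ∀ i → δ (run i) ((σ ∷ω _) i) (run (suc i)) ≡ true
    steps′ zero    = d
    steps′ (suc i) = steps i
    late′ : ∀ i → suc N ≤ i → α (run i) ((σ ∷ω _) i) (run (suc i)) ≡ false
    late′ (suc i) (s≤s N≤i) = late i N≤i

  Lang-++ω : ∀ {q q′ w} u → Path X q u q′ → Lang X q′ w → Lang X q (u ++ω w)
  Lang-++ω []      refl           l = l
  Lang-++ω (σ ∷ u) (_ , d , path) l = Lang-∷ω d (Lang-++ω u path l)

  Lang-uncons : ∀ {q w} → Lang X q w → ∃ λ q′ → δ q (w 0) q′ ≡ true × Lang X q′ (tailω w)
  Lang-uncons (r , (refl , steps) , (N , late)) =
    r 1 , steps 0 , (tailω r , (refl , λ i → steps (suc i)) , (N , λ i N≤i → late (suc i) (≤-trans N≤i (n≤1+n i))))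

  LangSafe-uncons : ∀ {q w} → LangSafe X q w → ∃ λ q′ → SafeEdge q (w 0) q′ × LangSafe X q′ (tailω w)
  LangSafe-uncons (r , (refl , steps) , safe) =
    r 1 , (steps 0 , safe 0) , (tailω r , (refl , λ i → steps (suc i)) , λ i → safe (suc i))

  LangSafe⇒Lang : ∀ {q w} → LangSafe X q w → Lang X q w
  LangSafe⇒Lang (r , run , safe) = r , run , (0 , λ i _ → safe i)

  module _ (I : Fin n → (ℕ → Fin k) → Set)
           (step : ∀ {q w} → I q w → ∃ λ q′ → SafeEdge q (w 0) q′ × I q′ (tailω w)) where

    private
      trace : ℕ → ∀ {q w} → I q w → Fin n
      trace zero    {q} _ = q
      trace (suc i) inv   = trace i (proj₂ (proj₂ (step inv)))

      trace-safe : ∀ i {q w} (inv : I q w) → SafeEdge (trace i inv) (w i) (trace (suc i) inv)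
      trace-safe zero    inv = proj₁ (proj₂ (step inv))
      trace-safe (suc i) inv = trace-safe i (proj₂ (proj₂ (step inv)))

    LangSafe-coinduction : ∀ {q w} → I q w → LangSafe X q w
    LangSafe-coinduction inv =
      (λ i → trace i inv) , (refl , λ i → proj₁ (trace-safe i inv)) , λ i → proj₂ (trace-safe i inv)

  SafePath⇒Path : ∀ {q s} x → SafePath X q x s → Path X q x s
  SafePath⇒Path []      refl              = refl
  SafePath⇒Path (σ ∷ x) (_ , d , _ , path) = _ , d , SafePath⇒Path x path

  SafePath-++ : ∀ {q s t} x {y} → SafePath X q x s → SafePath X s y t → SafePath X q (x ++ y) t
  SafePath-++ []      refl                   path₂ = path₂
  SafePath-++ (σ ∷ x) (_ , d , safe , path₁) path₂ = _ , d , safe , SafePath-++ x path₁ path₂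

  SafePath-++⁻ˡ : ∀ {q t} x {y} → SafePath X q (x ++ y) t → ∃ λ s → SafePath X q x s
  SafePath-++⁻ˡ []      _                     = _ , refl
  SafePath-++⁻ˡ (σ ∷ x) (s₁ , d , safe , path) = let (s , path′) = SafePath-++⁻ˡ x path in s , s₁ , d , safe , path′

  prefix-suc : ∀ w i → prefix X w (suc i) ≡ w 0 ∷ prefix X (tailω w) i
  prefix-suc w zero    = refl
  prefix-suc w (suc i) = cong (_∷ʳ w (suc i)) (prefix-suc w i)

open Automaton

Lang-⊆-step : ∀ {k nX nY} {X : TNCW k nX} {Y : TNCW k nY} → SemanticallyDeterministic Y →
              ∀ {x y x′ y′ σ} → (∀ w → Lang X x w → Lang Y y w) →
              TNCW.δ X x σ x′ ≡ true → TNCW.δ Y y σ y′ ≡ true → ∀ w → Lang X x′ w → Lang Y y′ w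
Lang-⊆-step {X = X} {Y} semY {y = y} {σ = σ} x⊆y dx dy w lx′ =
  let (y″ , dy″ , ly″) = Lang-uncons Y (x⊆y (σ ∷ω w) (Lang-∷ω X dx lx′))
  in proj₁ (semY y σ y″ _ dy″ dy w) ly″

module _ {m : ℕ} (F : Subset m → Subset m) (F-mono : ∀ {p q} → p ⊆ q → F p ⊆ F q)
         (P : Subset m → Set) (F-preserves : ∀ {X} → P X → P (F X)) where

  -- Each iteration that does not stop shrinks X strictly, and _⊂_ is well founded.
  iterate-to-postfixed : ∀ X → F X ⊆ X → P X → ∃ λ Y → Y ⊆ F Y × P Y
  iterate-to-postfixed X = go X (⊂-wellFounded X)
    where
    go : ∀ X → Acc _⊂_ X → F X ⊆ X → P X → ∃ λ Y → Y ⊆ F Y × P Y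
    go X (acc rs) FX⊆X pX with any? (λ i → i ∈? X ×-dec ¬? (i ∈? F X))
    ... | yes (i , i∈X , i∉FX) =
      go (F X) (rs (FX⊆X , i , i∈X , i∉FX)) (F-mono FX⊆X) (F-preserves pX)
    ... | no ¬shrinks =
      X , (λ {i} i∈X → decidable-stable (i ∈? F X) λ i∉FX → ¬shrinks (i , i∈X , i∉FX)) , pX

subset : ∀ {m} {P : Fin m → Set} → (∀ i → Dec (P i)) → Subset m
subset P? = tabulate (λ i → does (P? i))

module _ {m} {P : Fin m → Set} (P? : ∀ i → Dec (P i)) where

  ∈-subset⁺ : ∀ {i} → P i → i ∈ subset P?
  ∈-subset⁺ {i} p = lookup⇒[]= i _ (trans (lookup∘tabulate (λ j → does (P? j)) i) (dec-true (P? i) p))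

  ∈-subset⁻ : ∀ {i} → i ∈ subset P? → P i
  ∈-subset⁻ {i} i∈ with P? i | trans (sym (lookup∘tabulate (λ j → does (P? j)) i)) ([]=⇒lookup i∈)
  ... | yes p | _ = p
  ... | no _  | ()

module Comparison {k nA nB : ℕ} (A : TNCW k nA) (B : TNCW k nB) where

  _≋_ : Fin nA → Fin nB → Set
  a ≋ b = ∀ w → (Lang A a w → Lang B b w) × (Lang B b w → Lang A a w)

  ≋-path : SemanticallyDeterministic A → SemanticallyDeterministic B →
           ∀ {a b a′ b′} v → a ≋ b → Path A a v a′ → Path B b v b′ → a′ ≋ b′
  ≋-path semA semB []      a≋b refl           refl           = a≋b
  ≋-path semA semB (σ ∷ v) a≋b (_ , da , pathA) (_ , db , pathB) =
    ≋-path semA semB v (λ w → Lang-⊆-step {X = A} {B} semB (λ u → proj₁ (a≋b u)) da db w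
                            , Lang-⊆-step {X = B} {A} semA (λ u → proj₂ (a≋b u)) db da w) pathA pathB

  SafeIncluded : Fin nA → Fin nB → Set
  SafeIncluded a b = ∀ w → LangSafe A a w → LangSafe B b w

  Refuted : Fin nA → Fin nB → Set
  Refuted a b = ∃ λ x → (∃ λ a′ → SafePath A a x a′) × ¬ (∃ λ b′ → SafePath B b x b′)

  -- Relations between the state sets are subsets of Fin (nA * nB), on which _⊂_ is well founded.
  Related : Subset (nA * nB) → Fin nA → Fin nB → Set
  Related R a b = combine a b ∈ R

  Matched : Subset (nA * nB) → Fin k → Fin nA → Fin nB → Set
  Matched R σ a′ b = ∃ λ b′ → SafeEdge B b σ b′ × Related R a′ b′

  Simulates : Subset (nA * nB) → Fin nA → Fin nB → Set
  Simulates R a b = ∀ σ a′ → SafeEdge A a σ a′ → Matched R σ a′ b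

  matched? : ∀ R σ a′ b → Dec (Matched R σ a′ b)
  matched? R σ a′ b = any? λ b′ → safeEdge? B b σ b′ ×-dec (combine a′ b′ ∈? R)

  simulates-or-unmatched : ∀ R a b →
    Simulates R a b ⊎ ∃₂ λ σ a′ → SafeEdge A a σ a′ × ¬ Matched R σ a′ b
  simulates-or-unmatched R a b
    with any? (λ σ → any? λ a′ → safeEdge? A a σ a′ ×-dec ¬? (matched? R σ a′ b))
  ... | yes unmatched = inj₂ unmatched
  ... | no ¬unmatched = inj₁ λ σ a′ e →
    decidable-stable (matched? R σ a′ b) λ ¬m → ¬unmatched (σ , a′ , e , ¬m)

  simulates? : ∀ R a b → Dec (Simulates R a b)
  simulates? R a b with simulates-or-unmatched R a b
  ... | inj₁ sim                = yes sim
  ... | inj₂ (σ , a′ , e , ¬m) = no λ sim → ¬m (sim σ a′ e)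

  simulatesAt? : ∀ R i → Dec (uncurry (Simulates R) (remQuot nB i))
  simulatesAt? R i = uncurry (simulates? R) (remQuot nB i)

  step : Subset (nA * nB) → Subset (nA * nB)
  step R = subset (simulatesAt? R)

  ∈-step⁺ : ∀ {R a b} → Simulates R a b → Related (step R) a b
  ∈-step⁺ {R} {a} {b} sim =
    ∈-subset⁺ (simulatesAt? R) (subst (uncurry (Simulates R)) (sym (remQuot-combine a b)) sim)

  ∈-step⁻ : ∀ {R a b} → Related (step R) a b → Simulates R a b
  ∈-step⁻ {R} {a} {b} ab∈ = subst (uncurry (Simulates R)) (remQuot-combine a b) (∈-subset⁻ (simulatesAt? R) ab∈)

  simulates-mono : ∀ {R R′} → R ⊆ R′ → ∀ {a b} → Simulates R a b → Simulates R′ a b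
  simulates-mono R⊆R′ sim σ a′ e = let (b′ , e′ , r) = sim σ a′ e in b′ , e′ , R⊆R′ r

  step-mono : ∀ {R R′} → R ⊆ R′ → step R ⊆ step R′
  step-mono {R} {R′} R⊆R′ i∈ =
    ∈-subset⁺ (simulatesAt? R′) (simulates-mono R⊆R′ (∈-subset⁻ (simulatesAt? R) i∈))

  RefutedOutside : Subset (nA * nB) → Set
  RefutedOutside R = ∀ a b → ¬ Related R a b → Refuted a b

  -- Safe determinism of B makes the refuting word extend through the unique safe σ-successor.
  step-refutes : SafeDeterministic B → ∀ {R} → RefutedOutside R → RefutedOutside (step R)
  step-refutes det {R} out a b ab∉ with simulates-or-unmatched R a b
  ... | inj₁ sim = ⊥-elim (ab∉ (∈-step⁺ sim))
  ... | inj₂ (σ , a′ , (d , safe) , ¬m) with any? (λ b′ → safeEdge? B b σ b′)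
  ...   | no ¬e = [ σ ] , (a′ , a′ , d , safe , refl) , λ { (_ , b₁ , d₁ , safe₁ , _) → ¬e (b₁ , d₁ , safe₁) }
  ...   | yes (b₁ , e₁) =
    let (x , (a″ , path) , ¬path) = out a′ b₁ λ r → ¬m (b₁ , e₁ , r)
    in σ ∷ x , (a″ , a′ , d , safe , path) , λ { (b″ , b₂ , d₂ , safe₂ , path₂) →
         ¬path (b″ , subst (λ s → SafePath B s x b″) (det b σ b₂ b₁ d₂ safe₂ (proj₁ e₁) (proj₂ e₁)) path₂) }

  postfixed-sound : ∀ {Y} → Y ⊆ step Y → ∀ {a b} → Related Y a b → SafeIncluded a b
  postfixed-sound {Y} Y⊆stepY ab∈Y w la = LangSafe-coinduction B Simulated safe-step (_ , ab∈Y , la)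
    where
    Simulated : Fin nB → (ℕ → Fin k) → Set
    Simulated b w = ∃ λ a → Related Y a b × LangSafe A a w
    safe-step : ∀ {b w} → Simulated b w → ∃ λ b′ → SafeEdge B b (w 0) b′ × Simulated b′ (tailω w)
    safe-step {w = w} (a , ab∈Y , la) =
      let (a′ , e , la′)   = LangSafe-uncons A la
          (b′ , e′ , a′b′) = ∈-step⁻ (Y⊆stepY ab∈Y) (w 0) a′ e
      in b′ , e′ , a′ , a′b′ , la′

  safe-included-or-refuted : SafeDeterministic B → ∀ a b → SafeIncluded a b ⊎ Refuted a b
  safe-included-or-refuted det a b
    with iterate-to-postfixed step step-mono RefutedOutside (step-refutes det) ⊤ ⊆⊤ (λ _ _ ∉⊤ → ⊥-elim (∉⊤ ∈⊤))
  ... | Y , Y⊆stepY , out with combine a b ∈? Y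
  ...   | yes ab∈Y = inj₁ (postfixed-sound Y⊆stepY ab∈Y)
  ...   | no ab∉Y  = inj₂ (out a b ab∉Y)

module Strategy {k n : ℕ} (X : TNCW k n) (g : List (Fin k) → Fin n)
                (g-step : ∀ h σ → TNCW.δ X (g h) σ (g (h ∷ʳ σ)) ≡ true) where
  open TNCW X

  Path-strategy : ∀ h x → Path X (g h) x (g (after h x))
  Path-strategy h []      = refl
  Path-strategy h (σ ∷ x) = g (h ∷ʳ σ) , g-step h σ , Path-strategy (h ∷ʳ σ) x

  SafeAfter : List (Fin k) → (ℕ → Fin k) → ℕ → Set
  SafeAfter h w p = ∀ i → p ≤ i → α (g (h ++ prefix X w i)) (w i) (g (h ++ prefix X w (suc i))) ≡ false

  SafeAfter-mono : ∀ {h w p p′} → p ≤ p′ → SafeAfter h w p → SafeAfter h w p′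
  SafeAfter-mono p≤p′ safe i p′≤i = safe i (≤-trans p≤p′ p′≤i)

  SafeAfter-tail : ∀ {h w p} → SafeAfter h w (suc p) → SafeAfter (h ∷ʳ w 0) (tailω w) p
  SafeAfter-tail {h} {w} safe i p≤i =
    subst₂ (λ u v → α (g u) (w (suc i)) (g v) ≡ false) (shift i) (shift (suc i)) (safe (suc i) (s≤s p≤i))
    where
    shift : ∀ j → h ++ prefix X w (suc j) ≡ (h ∷ʳ w 0) ++ prefix X (tailω w) j
    shift j = trans (cong (h ++_) (prefix-suc X w j)) (sym (++-assoc h [ w 0 ] (prefix X (tailω w) j)))

  SafeAfter-head : ∀ {h w} → SafeAfter h w 0 → SafeEdge X (g h) (w 0) (g (h ∷ʳ w 0))
  SafeAfter-head {h} {w} safe =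
    g-step h (w 0) , subst (λ u → α (g u) (w 0) (g (h ∷ʳ w 0)) ≡ false) (++-identityʳ h) (safe 0 z≤n)

  SafeAfter-++ω : ∀ {h w p} x → SafeAfter h (x ++ω w) (length x + p) → SafeAfter (after h x) w p
  SafeAfter-++ω []      safe = safe
  SafeAfter-++ω (σ ∷ x) safe = SafeAfter-++ω x (SafeAfter-tail safe)

module EquivalentNice {k nA nB : ℕ} {A : TNCW k nA} {B : TNCW k nB} (niceA : Nice A) (niceB : Nice B)
             (q₀≋q₀ : Comparison._≋_ A B (TNCW.q₀ A) (TNCW.q₀ B)) where
  open Comparison A B
  open Nice
  module A = TNCW A
  module B = TNCW B

  g : List (Fin k) → Fin nB
  g = proj₁ (allGFG niceB B.q₀)

  g-ε : g [] ≡ B.q₀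
  g-ε = proj₁ (proj₂ (allGFG niceB B.q₀))

  g-step : ∀ h σ → B.δ (g h) σ (g (h ∷ʳ σ)) ≡ true
  g-step = proj₁ (proj₂ (proj₂ (allGFG niceB B.q₀)))

  g-accepts : ∀ w → Lang B B.q₀ w → Accepting B w (λ i → g (prefix B w i))
  g-accepts = proj₂ (proj₂ (proj₂ (allGFG niceB B.q₀)))

  open Strategy B g g-step

  ≋-strategy : ∀ {q} u → Path A A.q₀ u q → q ≋ g (after [] u)
  ≋-strategy u path = ≋-path (semDet niceA) (semDet niceB) u q₀≋q₀ path
    (subst (λ s → Path B s u (g (after [] u))) g-ε (Path-strategy [] u))

  Loop : Fin nA → Set
  Loop q = Σ (List⁺ (Fin k)) λ ℓ → SafePath A q (toList ℓ) q

  Blocked : Fin nB → List⁺ (Fin k) → Set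
  Blocked s ℓ = ¬ ∃ λ s′ → SafePath B s (toList ℓ) s′

  -- Normality closes the refuting word into a loop; the empty word never refutes.
  refuted⇒blocked-loop : ∀ {q s} → Refuted q s → Σ (Loop q) λ ℓ → Blocked s (proj₁ ℓ)
  refuted⇒blocked-loop ([]    , _           , ¬pathB) = ⊥-elim (¬pathB (_ , refl))
  refuted⇒blocked-loop (σ ∷ x , (a′ , pathA) , ¬pathB) =
    let (v , back) = normal niceA _ a′ (σ ∷ x , pathA)
    in (σ ∷ (x ++ v) , SafePath-++ A (σ ∷ x) pathA back) ,
       λ (_ , pathB) → ¬pathB (SafePath-++⁻ˡ B (σ ∷ x) pathB)

  -- From A's state q, read forever loops chosen by the current history h: a loop that g h cannot
  -- follow safely if there is one, otherwise the fallback loop.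
  module Pumping (q : Fin nA) (fallback : Loop q) where

    choice : ∀ h → Σ (Loop q) λ ℓ → SafeIncluded q (g h) ⊎ Blocked (g h) (proj₁ ℓ)
    choice h with safe-included-or-refuted (safeDet niceB) q (g h)
    ... | inj₁ incl = fallback , inj₁ incl
    ... | inj₂ ref  = let (ℓ , blocked) = refuted⇒blocked-loop ref in ℓ , inj₂ blocked

    loop : List (Fin k) → List⁺ (Fin k)
    loop h = proj₁ (proj₁ (choice h))

    loop-safe : ∀ h → SafePath A q (toList (loop h)) q
    loop-safe h = proj₂ (proj₁ (choice h))

    -- Reads the rest ℓ of the current loop; h is the history read so far.
    walk : List (Fin k) → List⁺ (Fin k) → ℕ → Fin k
    walk h (σ ∷ _)     zero    = σ
    walk h (σ ∷ [])    (suc i) = walk (h ∷ʳ σ) (loop (h ∷ʳ σ)) i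
    walk h (σ ∷ τ ∷ r) (suc i) = walk (h ∷ʳ σ) (τ ∷ r) i

    pumped : List (Fin k) → ℕ → Fin k
    pumped h = walk h (loop h)

    walk-safe : ∀ {a} h ℓ → SafePath A a (toList ℓ) q → LangSafe A a (walk h ℓ)
    walk-safe h ℓ path = LangSafe-coinduction A OnWalk walk-step (h , ℓ , path , refl)
      where
      OnWalk : Fin nA → (ℕ → Fin k) → Set
      OnWalk a w = ∃₂ λ h ℓ → SafePath A a (toList ℓ) q × w ≡ walk h ℓ
      walk-step : ∀ {a w} → OnWalk a w → ∃ λ a′ → SafeEdge A a (w 0) a′ × OnWalk a′ (tailω w)
      walk-step (h , σ ∷ []    , (_ , d , safe , refl) , refl) =
        q , (d , safe) , h ∷ʳ σ , loop (h ∷ʳ σ) , loop-safe (h ∷ʳ σ) , refl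
      walk-step (h , σ ∷ τ ∷ r , (a′ , d , safe , path) , refl) =
        a′ , (d , safe) , h ∷ʳ σ , τ ∷ r , path , refl

    SafeAfter⇒SafePath : ∀ h σ r → SafeAfter h (walk h (σ ∷ r)) 0 → ∃ λ s → SafePath B (g h) (σ ∷ r) s
    SafeAfter⇒SafePath h σ [] safe =
      let (d , α≡false) = SafeAfter-head safe in _ , _ , d , α≡false , refl
    SafeAfter⇒SafePath h σ (τ ∷ r) safe =
      let (d , α≡false) = SafeAfter-head safe
          (s , path)    = SafeAfter⇒SafePath (h ∷ʳ σ) τ r (SafeAfter-tail (SafeAfter-mono z≤n safe))
      in s , _ , d , α≡false , path

    SafeAfter-loop : ∀ {p} h σ r → SafeAfter h (walk h (σ ∷ r)) (suc (length r) + p) →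
                     SafeAfter (after h (σ ∷ r)) (pumped (after h (σ ∷ r))) p
    SafeAfter-loop h σ []      safe = SafeAfter-tail safe
    SafeAfter-loop h σ (τ ∷ r) safe = SafeAfter-loop (h ∷ʳ σ) τ r (SafeAfter-tail safe)

    -- Each loop consumes at least one position of the safe suffix; once none is left, the loop
    -- chosen at h is followed safely by g h, so it was not a blocked one.
    eventually-included : ∀ p h → q ≋ g h → SafeAfter h (pumped h) p → ∃ λ s → q ≋ s × SafeIncluded q s
    eventually-included zero h q≋gh safe =
      g h , q≋gh , [ id , (λ blocked → ⊥-elim (blocked (SafeAfter⇒SafePath h _ _ safe))) ]′ (proj₂ (choice h))
    eventually-included (suc p) h q≋gh safe =
      eventually-included p (after h ℓ)
        (≋-path (semDet niceA) (semDet niceB) ℓ q≋gh (SafePath⇒Path A ℓ (loop-safe h)) (Path-strategy h ℓ))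
        (SafeAfter-loop h _ _ (SafeAfter-mono (s≤s (m≤n+m p (length (List⁺.tail (loop h))))) safe))
      where
      ℓ : List (Fin k)
      ℓ = toList (loop h)

    -- The pumped word after u is in L(A), so the GFG run of B on it is eventually safe.
    included-from : ∀ u → Path A A.q₀ u q → ∃ λ s → q ≋ s × SafeIncluded q s
    included-from u path =
      eventually-included N h (≋-strategy u path) (SafeAfter-++ω u (SafeAfter-mono (m≤n+m N (length u)) late))
      where
      h : List (Fin k)
      h = after [] u
      inB : Lang B B.q₀ (u ++ω pumped h)
      inB = proj₁ (q₀≋q₀ _) (Lang-++ω A u path (LangSafe⇒Lang A (walk-safe h (loop h) (loop-safe h))))
      N : ℕ
      N = proj₁ (g-accepts _ inB)
      late : SafeAfter [] (u ++ω pumped h) N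
      late = proj₂ (g-accepts _ inB)

proposition3p3 : (k nA nB : ℕ) (A : TNCW k nA) (B : TNCW k nB) →
    Nice A → Nice B →
    (∀ w → (Lang A (TNCW.q₀ A) w → Lang B (TNCW.q₀ B) w) ×
           (Lang B (TNCW.q₀ B) w → Lang A (TNCW.q₀ A) w)) →
    ∀ (q : Fin nA) → ∃ λ (s : Fin nB) →
      (∀ w → (Lang A q w → Lang B s w) × (Lang B s w → Lang A q w)) ×
      (∀ w → LangSafe A q w → LangSafe B s w)
proposition3p3 k nA nB A B niceA niceB q₀≋q₀ q =
  let (u , path) = Nice.allReachable niceA q in
  [ (λ incl → g (after [] u) , ≋-strategy u path , incl)
  , (λ ref → Pumping.included-from q (proj₁ (refuted⇒blocked-loop ref)) u path)
  ]′ (safe-included-or-refuted (Nice.safeDet niceB) q (g (after [] u)))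
  where
  open Comparison A B
  open EquivalentNice niceA niceB q₀≋q₀
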